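{- Let $G$ be a graph whose twin graph $G^*$ is isomorphic to $K_3$ with at most one vertex of $G^*$ of type (1K). Then $D(G)=n(G)-2$ if and only if $G$ is isomorphic to $K_{1,2,2}$ or to $K_{1,1,t}$ for some $t\geq 2$.
   Context: All graphs are finite and simple; $n(G)$ is the number of vertices. Two vertices $u,v$ are twins if $N_G(v)\setminus\{u\}=N_G(u)\setminus\{v\}$; the relation "$u=v$ or $u,v$ twins" is an equivalence relation with class $v^*$ of $v$. The twin graph $G^*$ has vertex set $\{v^*\}$ and edges $u^*v^*$ for $uv\in E(G)$. Each class induces a complete or edgeless graph; $v^*$ is of type (1) if $|v^*|=1$, of type (K) if it induces $K_r$ with $r\geq2$, of type (N) if it induces $\overline{K_r}$ with $r\geq 2$; type (1K) means type (1) or (K). $K_{a,b,c}$ is the complete tripartite graph. $D(G)$ is the minimum number of colors in a vertex coloring preserved by no non-trivial automorphism of $G$. -}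

module Defs where

open import Data.Nat using (ℕ; _+_; _≤_; _∸_)
import Data.Fin
open import Data.Fin using (Fin; splitAt; _≟_)
open import Data.Bool using (Bool; true; false; not)
open import Data.Sum using (_⊎_; inj₁; inj₂)
open import Data.Product using (Σ; _×_; ∃; ∃-syntax)
open import Relation.Nullary using (¬_; does)
open import Relation.Binary.PropositionalEquality using (_≡_; _≢_; refl)
open import Function.Bundles using (_↔_; _⇔_; Inverse)

record Graph (n : ℕ) : Set where
  field
    adj    : Fin n → Fin n → Bool
    sym    : ∀ u v → adj u v ≡ adj v u
    irrefl : ∀ u → adj u u ≡ false

open Graph public

module _ {n : ℕ} (G : Graph n) where

  _∈N_ : Fin n → Fin n → Set
  w ∈N v = adj G v w ≡ true

  Twins : Fin n → Fin n → Set
  Twins u v = ∀ w → (w ∈N v × w ≢ u) ⇔ (w ∈N u × w ≢ v)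

  TwinEq : Fin n → Fin n → Set
  TwinEq u v = u ≡ v ⊎ Twins u v

  -- the class v* is of type (1) or (K): any two distinct members are adjacent
  TypeOneK : Fin n → Set
  TypeOneK v = ∀ u w → TwinEq u v → TwinEq w v → u ≢ w → adj G u w ≡ true

  AtMostOneOneK : Set
  AtMostOneOneK = ∀ v w → TypeOneK v → TypeOneK w → TwinEq v w

  -- G* ≅ K₃: a bijection f between the twin classes and Fin 3
  -- (f u ≡ f v exactly when u* = v*, f onto), such that the edges of G*
  -- (pairs u*v* with uv ∈ E(G), u* ≠ v*) are exactly all pairs of
  -- distinct vertices of K₃.
  TwinGraphIsoK3 : Set
  TwinGraphIsoK3 =
    Σ (Fin n → Fin 3) λ f →
      (∀ u v → (f u ≡ f v) ⇔ TwinEq u v) ×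
      (∀ i → ∃[ u ] f u ≡ i) ×
      (∀ i j → i ≢ j → ∃[ u ] ∃[ v ] (f u ≡ i × f v ≡ j × adj G u v ≡ true))

  IsAut : (Fin n ↔ Fin n) → Set
  IsAut σ = ∀ u v → adj G (Inverse.to σ u) (Inverse.to σ v) ≡ adj G u v

  Distinguishing : ℕ → Set
  Distinguishing k =
    Σ (Fin n → Fin k) λ c →
      ∀ (σ : Fin n ↔ Fin n) → IsAut σ →
        (∀ u → c (Inverse.to σ u) ≡ c u) → ∀ u → Inverse.to σ u ≡ u

  DistNumberIs : ℕ → Set
  DistNumberIs k = Distinguishing k × (∀ m → Distinguishing m → k ≤ m)

_≅_ : ∀ {n m} → Graph n → Graph m → Set
_≅_ {n} {m} G H =
  Σ (Fin n ↔ Fin m) λ φ →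
    ∀ u v → adj H (Inverse.to φ u) (Inverse.to φ v) ≡ adj G u v

-- the complete tripartite graph K_{a,b,c} on Fin (a + b + c):
-- the first a vertices form part 0, the next b part 1, the last c part 2;
-- two vertices are adjacent iff they lie in different parts.
p0 p1 p2 : Fin 3
p0 = Data.Fin.zero
p1 = Data.Fin.suc Data.Fin.zero
p2 = Data.Fin.suc (Data.Fin.suc Data.Fin.zero)

part : ∀ a b c → Fin (a + b + c) → Fin 3
part a b c u with splitAt (a + b) u
... | inj₂ _ = p2
... | inj₁ x with splitAt a x
...   | inj₁ _ = p0
...   | inj₂ _ = p1

differ : Fin 3 → Fin 3 → Bool
differ i j = not (does (i ≟ j))

private
  differ-sym : ∀ i j → differ i j ≡ differ j i
  differ-sym Data.Fin.zero Data.Fin.zero = refl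
  differ-sym Data.Fin.zero (Data.Fin.suc Data.Fin.zero) = refl
  differ-sym Data.Fin.zero (Data.Fin.suc (Data.Fin.suc Data.Fin.zero)) = refl
  differ-sym (Data.Fin.suc Data.Fin.zero) Data.Fin.zero = refl
  differ-sym (Data.Fin.suc Data.Fin.zero) (Data.Fin.suc Data.Fin.zero) = refl
  differ-sym (Data.Fin.suc Data.Fin.zero) (Data.Fin.suc (Data.Fin.suc Data.Fin.zero)) = refl
  differ-sym (Data.Fin.suc (Data.Fin.suc Data.Fin.zero)) Data.Fin.zero = refl
  differ-sym (Data.Fin.suc (Data.Fin.suc Data.Fin.zero)) (Data.Fin.suc Data.Fin.zero) = refl
  differ-sym (Data.Fin.suc (Data.Fin.suc Data.Fin.zero)) (Data.Fin.suc (Data.Fin.suc Data.Fin.zero)) = refl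

  differ-irr : ∀ i → differ i i ≡ false
  differ-irr Data.Fin.zero = refl
  differ-irr (Data.Fin.suc Data.Fin.zero) = refl
  differ-irr (Data.Fin.suc (Data.Fin.suc Data.Fin.zero)) = refl

K : (a b c : ℕ) → Graph (a + b + c)
K a b c = record
  { adj    = λ u v → differ (part a b c u) (part a b c v)
  ; sym    = λ u v → differ-sym (part a b c u) (part a b c v)
  ; irrefl = λ u → differ-irr (part a b c u)
  }

module Submission where

open import Defs hiding (sym; irrefl)
open import Data.Nat using (ℕ; _≤_; _≰_; _∸_; _+_; suc; zero; s≤s; z≤n; _≤?_)
open import Data.Nat.Properties using (+-suc; +-identityʳ; +-∸-assoc; m+1+n≰m; ≰⇒>)
open import Data.Fin using (Fin; zero; suc; punchOut; _≟_; inject≤; join)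
open import Data.Fin.Patterns using (0F; 1F; 2F; 3F; 4F)
open import Data.Fin.Properties
  using (punchOut-injective; ¬Fin0; inject≤-injective; cantor-schröder-bernstein; +↔⊎; all?; any?)
open import Data.Fin.Permutation using (Permutation′; transpose; _∘ₚ_)
open import Data.Bool using (true; false)
import Data.Bool as Bool
open import Data.Sum using (_⊎_; inj₁; inj₂; swap)
import Data.Sum as Sum
open import Data.Sum.Properties using (swap-involutive)
open import Data.Product using (Σ; _×_; _,_; proj₁; ∃-syntax)
open import Data.Empty using (⊥; ⊥-elim)
open import Data.Unit using (tt)
open import Data.List using (List; []; _∷_)
open import Data.List.Relation.Unary.All as All using (All; lookupWith)
import Data.List.Relation.Unary.Any as Any
open Any using (Any)
open import Data.Vec using (Vec; []; _∷_; lookup)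
open import Data.Vec.Properties using (lookup∘tabulate)
open import Data.Vec.Membership.Propositional using (_∈_; _∉_)
import Data.Vec.Relation.Unary.Any as VecAny
open VecAny using (here; there; index)
open import Data.Vec.Relation.Unary.Any.Properties using (lookup-index)
open import Data.Vec.Relation.Unary.AllPairs using ([]; _∷_)
open import Data.Vec.Relation.Unary.All using ([]; _∷_)
open import Data.Vec.Relation.Unary.Unique.Propositional using (Unique)
open import Data.Vec.Relation.Unary.Unique.Propositional.Properties using (lookup-injective)
open import Function using (_∘_; id)
open import Function.Bundles using (_↔_; _⇔_; Inverse; Equivalence; Injection; mk⇔; mk↔ₛ′)
open import Function.Definitions using (Injective)
open import Function.Properties.Inverse using (↔-sym; ↔-trans; ↔⇒↣)
import Function.Properties.Equivalence as ⇔
open import Relation.Nullary using (¬_; Dec; yes; no; contradiction)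
open import Relation.Nullary.Decidable using (toWitness; decidable-stable; ¬?; _×-dec_; _⊎-dec_; _→-dec_)
open import Relation.Binary.PropositionalEquality
  using (_≡_; _≢_; ≢-sym; refl; sym; trans; cong; cong₂; subst; subst₂; module ≡-Reasoning)
open ≡-Reasoning

-- Vertices in different twin classes are adjacent, and since at most one class is of
-- type (1K), two classes P and Q contain non-adjacent pairs {p, p′} and {q, q′}; let r lie
-- in the third class R. If G has any further vertex w, pair up three disjoint couples of
-- vertices from different classes, give each couple one colour and every other vertex its
-- own: a colour-preserving automorphism permutes the classes, the couples prevent it from
-- moving any class, and inside a class all colours differ, so D(G) ≤ n − 3. Otherwise
-- G = {r, p, p′, q, q′} is K_{1,2,2}, and D(K_{1,2,2}) = 3 = 5 − 2 by inspection. The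
-- alternative K_{1,1,t} never occurs: its vertices on non-edges are pairwise non-adjacent,
-- whereas p and q are adjacent.

Fin3-cover : ∀ (X Y Z : Fin 3) → X ≢ Y → X ≢ Z → Y ≢ Z → ∀ k → k ≡ X ⊎ k ≡ Y ⊎ k ≡ Z
Fin3-cover = toWitness {a? = all? λ X → all? λ Y → all? λ Z →
  ¬? (X ≟ Y) →-dec ¬? (X ≟ Z) →-dec ¬? (Y ≟ Z) →-dec all? λ k → (k ≟ X) ⊎-dec (k ≟ Y) ⊎-dec (k ≟ Z)} tt

Fin3-third : ∀ (X Y : Fin 3) → X ≢ Y → ∃[ Z ] X ≢ Z × Y ≢ Z
Fin3-third = toWitness {a? = all? λ X → all? λ Y →
  ¬? (X ≟ Y) →-dec any? λ Z → ¬? (X ≟ Z) ×-dec ¬? (Y ≟ Z)} tt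

differ-≡ : ∀ {i j} → i ≡ j → differ i j ≡ false
differ-≡ {i} {j} i≡j with i ≟ j
... | yes _   = refl
... | no i≢j = contradiction i≡j i≢j

differ-true⇒≢ : ∀ {i j} → differ i j ≡ true → i ≢ j
differ-true⇒≢ differs i≡j = contradiction (trans (sym differs) (differ-≡ i≡j)) λ ()

enumeration↔ : ∀ {a} {A : Set a} {k} (xs : Vec A k) → Unique xs → (∀ x → x ∈ xs) → Fin k ↔ A
enumeration↔ xs xs-unique xs-complete = mk↔ₛ′ (lookup xs) (index ∘ xs-complete)
  (λ x → sym (lookup-index (xs-complete x)))
  (λ i → lookup-injective xs-unique _ _ (sym (lookup-index (xs-complete (lookup xs i)))))

complete-or-missing : ∀ {n k} (xs : Vec (Fin n) k) → (∀ u → u ∈ xs) ⊎ ∃[ w ] w ∉ xs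
complete-or-missing xs with any? (λ w → ¬? (VecAny.any? (w ≟_) xs))
... | yes missing     = inj₂ missing
... | no none-missing = inj₁ λ u → decidable-stable (VecAny.any? (u ≟_) xs) (none-missing ∘ (u ,_))

merge : ∀ {m} {p q : Fin (suc m)} → p ≢ q → Fin (suc m) → Fin m
merge {p = p} p≢q x with p ≟ x
... | yes _  = punchOut p≢q
... | no p≢x = punchOut p≢x

merge-fibre : ∀ {m} {p q : Fin (suc m)} (p≢q : p ≢ q) {x y} → merge p≢q x ≡ merge p≢q y →
  x ≡ y ⊎ (x ≡ p × y ≡ q) ⊎ (x ≡ q × y ≡ p)
merge-fibre {p = p} p≢q {x} {y} e with p ≟ x | p ≟ y
... | yes refl | yes refl = inj₁ refl
... | yes refl | no p≢y   = inj₂ (inj₁ (refl , sym (punchOut-injective p≢q p≢y e)))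
... | no p≢x   | yes refl = inj₂ (inj₂ (punchOut-injective p≢x p≢q e , refl))
... | no p≢x   | no p≢y   = inj₁ (punchOut-injective p≢x p≢y e)

-- h s and h (swap s) are the two ends of the s-th pair.
Paired : ∀ {k n} → (Fin k ⊎ Fin k → Fin n) → Fin n → Fin n → Set
Paired h x y = x ≡ y ⊎ ∃[ s ] x ≡ h s × y ≡ h (swap s)

Paired-partner : ∀ {k n} {h : Fin k ⊎ Fin k → Fin n} → Injective _≡_ _≡_ h →
  ∀ {x} s → Paired h x (h s) → x ≡ h s ⊎ x ≡ h (swap s)
Paired-partner h-injective s (inj₁ x≡hs) = inj₁ x≡hs
Paired-partner {h = h} h-injective s (inj₂ (t , x≡ht , hs≡h[swap-t])) =
  inj₂ (trans x≡ht (cong h (trans (sym (swap-involutive t))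
                                  (cong swap (sym (h-injective hs≡h[swap-t]))))))

suc⊎suc : ∀ {k} → Fin k ⊎ Fin k → Fin (suc k) ⊎ Fin (suc k)
suc⊎suc = Sum.map suc suc

suc⊎suc-injective : ∀ {k} → Injective _≡_ _≡_ (suc⊎suc {k})
suc⊎suc-injective {x = inj₁ i} {inj₁ .i} refl = refl
suc⊎suc-injective {x = inj₂ i} {inj₂ .i} refl = refl

pairing-colouring : ∀ {k n} (h : Fin k ⊎ Fin k → Fin n) → Injective _≡_ _≡_ h →
  ∃[ m ] m + k ≡ n × Σ (Fin n → Fin m) λ c → ∀ {x y} → c x ≡ c y → Paired h x y
pairing-colouring {zero} h _ = _ , +-identityʳ _ , id , inj₁
pairing-colouring {suc k} {n} h h-injective
  with pairing-colouring (h ∘ suc⊎suc) (suc⊎suc-injective ∘ h-injective)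
... | zero , _ , c , _ = ⊥-elim (¬Fin0 (c (h (inj₁ zero))))
... | suc m , m+k≡n , c , c-paired = m , trans (+-suc m k) m+k≡n , merge ca≢cb ∘ c , paired
  where
  h′ : Fin k ⊎ Fin k → Fin n
  h′ = h ∘ suc⊎suc

  a b : Fin n
  a = h (inj₁ zero)
  b = h (inj₂ zero)

  fresh : ∀ {x} t → (∀ s → t ≢ suc⊎suc s) → Paired h′ x (h t) → x ≡ h t
  fresh t _     (inj₁ x≡ht)             = x≡ht
  fresh t t-new (inj₂ (s , _ , ht≡h′s)) = contradiction (h-injective ht≡h′s) (t-new (swap s))

  a-new : ∀ s → inj₁ zero ≢ suc⊎suc s
  a-new (inj₁ _) ()
  a-new (inj₂ _) ()

  b-new : ∀ s → inj₂ zero ≢ suc⊎suc s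
  b-new (inj₁ _) ()
  b-new (inj₂ _) ()

  ca≢cb : c a ≢ c b
  ca≢cb ca≡cb with h-injective (fresh (inj₁ zero) a-new (c-paired (sym ca≡cb)))
  ... | ()

  shift : ∀ {x y} → Paired h′ x y → Paired h x y
  shift (inj₁ x≡y)                    = inj₁ x≡y
  shift (inj₂ (inj₁ i , x≡h′s , y≡h′s′)) = inj₂ (inj₁ (suc i) , x≡h′s , y≡h′s′)
  shift (inj₂ (inj₂ i , x≡h′s , y≡h′s′)) = inj₂ (inj₂ (suc i) , x≡h′s , y≡h′s′)

  paired : ∀ {x y} → merge ca≢cb (c x) ≡ merge ca≢cb (c y) → Paired h x y
  paired merged with merge-fibre ca≢cb merged
  ... | inj₁ cx≡cy = shift (c-paired cx≡cy)
  ... | inj₂ (inj₁ (cx≡ca , cy≡cb)) =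
    inj₂ (inj₁ zero , fresh _ a-new (c-paired cx≡ca) , fresh _ b-new (c-paired cy≡cb))
  ... | inj₂ (inj₂ (cx≡cb , cy≡ca)) =
    inj₂ (inj₂ zero , fresh _ b-new (c-paired cx≡cb) , fresh _ a-new (c-paired cy≡ca))

↔-injective : ∀ {a b} {A : Set a} {B : Set b} (φ : A ↔ B) → Injective _≡_ _≡_ (Inverse.to φ)
↔-injective φ = Injection.injective (↔⇒↣ φ)

module _ {n m} {G : Graph n} {H : Graph m} where

  ≅-sym : G ≅ H → H ≅ G
  ≅-sym (φ , φ-adj) = ↔-sym φ , λ u v → begin
    adj G (from u) (from v)           ≡⟨ φ-adj (from u) (from v) ⟨
    adj H (to (from u)) (to (from v)) ≡⟨ cong₂ (adj H) (strictlyInverseˡ u) (strictlyInverseˡ v) ⟩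
    adj H u v                         ∎
    where open Inverse φ

  ≅-size : G ≅ H → n ≡ m
  ≅-size (φ , _) = cantor-schröder-bernstein (↔-injective φ) (↔-injective (↔-sym φ))

  Distinguishing-≅ : ∀ {k} → G ≅ H → Distinguishing H k → Distinguishing G k
  Distinguishing-≅ (φ , φ-adj) (c , c-dist) = c ∘ to , fixes
    where
    open Inverse φ
    fixes : ∀ σ → IsAut G σ → (∀ u → c (to (Inverse.to σ u)) ≡ c (to u)) → ∀ u → Inverse.to σ u ≡ u
    fixes σ σ-aut σ-pres u = ↔-injective φ (begin
      to (s u)             ≡⟨ cong (to ∘ s) (strictlyInverseʳ u) ⟨
      to (s (from (to u))) ≡⟨ c-dist τ τ-aut τ-pres (to u) ⟩
      to u                 ∎)
      where
      s : Fin n → Fin n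
      s = Inverse.to σ

      τ : Fin m ↔ Fin m
      τ = ↔-trans (↔-trans (↔-sym φ) σ) φ

      τ-aut : IsAut H τ
      τ-aut a b = begin
        adj H (to (s (from a))) (to (s (from b))) ≡⟨ φ-adj (s (from a)) (s (from b)) ⟩
        adj G (s (from a)) (s (from b))           ≡⟨ σ-aut (from a) (from b) ⟩
        adj G (from a) (from b)                   ≡⟨ φ-adj (from a) (from b) ⟨
        adj H (to (from a)) (to (from b))         ≡⟨ cong₂ (adj H) (strictlyInverseˡ a)
                                                                     (strictlyInverseˡ b) ⟩
        adj H a b                                 ∎

      τ-pres : ∀ a → c (to (s (from a))) ≡ c a
      τ-pres a = trans (σ-pres (from a)) (cong c (strictlyInverseˡ a))

DistNumberIs-≅ : ∀ {n m k} {G : Graph n} {H : Graph m} → G ≅ H → DistNumberIs H k → DistNumberIs G k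
DistNumberIs-≅ {G = G} {H} G≅H (dist , minimal) =
  Distinguishing-≅ {G = G} {H} G≅H dist ,
  λ k′ dist′ → minimal k′ (Distinguishing-≅ {G = H} {G} (≅-sym {G = G} {H} G≅H) dist′)

module _ {n} (G : Graph n) where

  Distinguishing-mono : ∀ {k k′} → k ≤ k′ → Distinguishing G k → Distinguishing G k′
  Distinguishing-mono k≤k′ (c , c-dist) = (λ u → inject≤ (c u) k≤k′) ,
    λ σ σ-aut σ-pres → c-dist σ σ-aut λ u → inject≤-injective k≤k′ k≤k′ _ _ (σ-pres u)

  IsAut-inverse : ∀ {σ} → IsAut G σ → IsAut G (↔-sym σ)
  IsAut-inverse {σ} σ-aut u v = begin
    adj G (from u) (from v)           ≡⟨ σ-aut (from u) (from v) ⟨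
    adj G (to (from u)) (to (from v)) ≡⟨ cong₂ (adj G) (strictlyInverseˡ u) (strictlyInverseˡ v) ⟩
    adj G u v                         ∎
    where open Inverse σ

  TwinEq-adj : ∀ {u v w} → TwinEq G u v → w ≢ u → w ≢ v → adj G u w ≡ adj G v w
  TwinEq-adj (inj₁ refl) _ _ = refl
  TwinEq-adj {u} {v} {w} (inj₂ twins) w≢u w≢v with adj G u w in u~w | adj G v w in v~w
  ... | true  | true  = refl
  ... | false | false = refl
  ... | true  | false =
    contradiction (trans (sym (proj₁ (Equivalence.from (twins w) (u~w , w≢v)))) v~w) λ ()
  ... | false | true  =
    contradiction (trans (sym (proj₁ (Equivalence.to (twins w) (v~w , w≢u)))) u~w) λ ()

  module _ {σ : Fin n ↔ Fin n} (σ-aut : IsAut G σ) where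
    open Inverse σ

    IsAut-∈N-≢ : ∀ a b x → (_∈N_ G (to x) (to a) × to x ≢ to b) ⇔ (_∈N_ G x a × x ≢ b)
    IsAut-∈N-≢ a b x = mk⇔
      (λ (a~x , x≢b) → trans (sym (σ-aut a x)) a~x , x≢b ∘ cong to)
      (λ (a~x , x≢b) → trans (σ-aut a x) a~x , x≢b ∘ ↔-injective σ)

    IsAut-TwinEq : ∀ {u v} → TwinEq G u v → TwinEq G (to u) (to v)
    IsAut-TwinEq (inj₁ u≡v)           = inj₁ (cong to u≡v)
    IsAut-TwinEq {u} {v} (inj₂ twins) = inj₂ λ w → subst
      (λ w → (_∈N_ G w (to v) × w ≢ to u) ⇔ (_∈N_ G w (to u) × w ≢ to v)) (strictlyInverseˡ w)
      (⇔.trans (IsAut-∈N-≢ v u (from w)) (⇔.trans (twins (from w)) (⇔.sym (IsAut-∈N-≢ u v (from w)))))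

  IsAut-TwinEq⁻ : ∀ {σ} → IsAut G σ →
    ∀ {u v} → TwinEq G (Inverse.to σ u) (Inverse.to σ v) → TwinEq G u v
  IsAut-TwinEq⁻ {σ} σ-aut {u} {v} = subst₂ (TwinEq G) (strictlyInverseʳ u) (strictlyInverseʳ v)
                                  ∘ IsAut-TwinEq {↔-sym σ} (IsAut-inverse {σ} σ-aut)
    where open Inverse σ

K122 : Graph 5
K122 = K 1 2 2

-- The parts are {0}, {1, 2}, {3, 4}. Vertices 2 and 4 get colours of their own, and
-- every vertex is determined by its colour and its adjacency to 2 and to 4.
K122-colouring : Fin 5 → Fin 3
K122-colouring = lookup (0F ∷ 0F ∷ 1F ∷ 0F ∷ 2F ∷ [])

K122-colour-unique : ∀ x → x ≡ 2F ⊎ x ≡ 4F → ∀ y → K122-colouring y ≡ K122-colouring x → y ≡ x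
K122-colour-unique = toWitness {a? = all? λ x → ((x ≟ 2F) ⊎-dec (x ≟ 4F)) →-dec
  all? λ y → (K122-colouring y ≟ K122-colouring x) →-dec (y ≟ x)} tt

K122-signature-injective : ∀ x y → K122-colouring x ≡ K122-colouring y →
  adj K122 x 2F ≡ adj K122 y 2F → adj K122 x 4F ≡ adj K122 y 4F → x ≡ y
K122-signature-injective = toWitness {a? = all? λ x → all? λ y →
  (K122-colouring x ≟ K122-colouring y) →-dec (adj K122 x 2F Bool.≟ adj K122 y 2F) →-dec
  (adj K122 x 4F Bool.≟ adj K122 y 4F) →-dec (x ≟ y)} tt

K122-distinguishing : Distinguishing K122 3
K122-distinguishing = K122-colouring , fixes
  where
  fixes : ∀ σ → IsAut K122 σ → (∀ u → K122-colouring (Inverse.to σ u) ≡ K122-colouring u) →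
    ∀ u → Inverse.to σ u ≡ u
  fixes σ σ-aut σ-pres u =
    K122-signature-injective (s u) u (σ-pres u) (same-adj 2F (inj₁ refl)) (same-adj 4F (inj₂ refl))
    where
    s : Fin 5 → Fin 5
    s = Inverse.to σ

    same-adj : ∀ x → x ≡ 2F ⊎ x ≡ 4F → adj K122 (s u) x ≡ adj K122 u x
    same-adj x x-unique = begin
      adj K122 (s u) x     ≡⟨ cong (adj K122 (s u)) (K122-colour-unique x x-unique (s x) (σ-pres x)) ⟨
      adj K122 (s u) (s x) ≡⟨ σ-aut u x ⟩
      adj K122 u x         ∎

K122-symmetries : List (Permutation′ 5)
K122-symmetries =
  transpose 1F 2F ∷ transpose 3F 4F ∷
  (transpose 1F 3F ∘ₚ transpose 2F 4F) ∷ (transpose 1F 4F ∘ₚ transpose 2F 3F) ∷ []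

K122-symmetries-nontrivial : All (λ σ → IsAut K122 σ × ∃[ u ] Inverse.to σ u ≢ u) K122-symmetries
K122-symmetries-nontrivial = toWitness {a? = All.all? (λ σ →
  (all? λ u → all? λ v → adj K122 (Inverse.to σ u) (Inverse.to σ v) Bool.≟ adj K122 u v) ×-dec
  any? λ u → ¬? (Inverse.to σ u ≟ u)) K122-symmetries} tt

K122-2-colouring-symmetric : ∀ (c : Fin 5 → Fin 2) →
  Any (λ σ → ∀ u → c (Inverse.to σ u) ≡ c u) K122-symmetries
K122-2-colouring-symmetric c = Any.map
  (λ preserves u → trans (sym (lookup∘tabulate c _)) (trans (preserves u) (lookup∘tabulate c u)))
  (by-values (c 0F) (c 1F) (c 2F) (c 3F) (c 4F))
  where
  by-values : ∀ c₀ c₁ c₂ c₃ c₄ → let c′ = lookup (c₀ ∷ c₁ ∷ c₂ ∷ c₃ ∷ c₄ ∷ []) in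
    Any (λ σ → ∀ u → c′ (Inverse.to σ u) ≡ c′ u) K122-symmetries
  by-values = toWitness {a? = all? λ c₀ → all? λ c₁ → all? λ c₂ → all? λ c₃ → all? λ c₄ →
    let c′ = lookup (c₀ ∷ c₁ ∷ c₂ ∷ c₃ ∷ c₄ ∷ []) in
    Any.any? (λ σ → all? λ u → c′ (Inverse.to σ u) ≟ c′ u) K122-symmetries} tt

K122-DistNumber : DistNumberIs K122 3
K122-DistNumber = K122-distinguishing , at-least-3
  where
  no-2-colouring : ¬ Distinguishing K122 2
  no-2-colouring (c , c-dist) = lookupWith {R = λ _ → ⊥}
    (λ {σ} (σ-aut , u , σu≢u) preserves → σu≢u (c-dist σ σ-aut preserves u))
    K122-symmetries-nontrivial (K122-2-colouring-symmetric c)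

  at-least-3 : ∀ k → Distinguishing K122 k → 3 ≤ k
  at-least-3 k dist with k ≤? 2
  ... | yes k≤2 = contradiction (Distinguishing-mono K122 k≤2 dist) no-2-colouring
  ... | no k≰2  = ≰⇒> k≰2

K122-mate : Fin 5 → Fin 5
K122-mate = lookup (0F ∷ 2F ∷ 1F ∷ 4F ∷ 3F ∷ [])

K122-non-adjacent : ∀ i j → adj K122 i j ≡ false → j ≡ i ⊎ j ≡ K122-mate i
K122-non-adjacent = toWitness {a? = all? λ i → all? λ j →
  (adj K122 i j Bool.≟ false) →-dec ((j ≟ i) ⊎-dec (j ≟ K122-mate i))} tt

K11-non-edge-part : ∀ t {a b : Fin (1 + 1 + t)} → a ≢ b → adj (K 1 1 t) a b ≡ false → part 1 1 t a ≡ p2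
K11-non-edge-part t {0F}          {0F}          a≢b _ = contradiction refl a≢b
K11-non-edge-part t {0F}          {1F}          _   ()
K11-non-edge-part t {0F}          {suc (suc _)} _   ()
K11-non-edge-part t {1F}          {0F}          _   ()
K11-non-edge-part t {1F}          {1F}          a≢b _ = contradiction refl a≢b
K11-non-edge-part t {1F}          {suc (suc _)} _   ()
K11-non-edge-part t {suc (suc _)} {_}           _   _ = refl

K11-non-edges-independent : ∀ t {a a′ b b′ : Fin (1 + 1 + t)} →
  a ≢ a′ → adj (K 1 1 t) a a′ ≡ false → b ≢ b′ → adj (K 1 1 t) b b′ ≡ false → adj (K 1 1 t) a b ≡ false
K11-non-edges-independent t a≢a′ a≁a′ b≢b′ b≁b′ =
  differ-≡ (trans (K11-non-edge-part t a≢a′ a≁a′) (sym (K11-non-edge-part t b≢b′ b≁b′)))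

module TwinClasses {n} (G : Graph n) (f : Fin n → Fin 3)
  (f≡⇔TwinEq : ∀ u v → (f u ≡ f v) ⇔ TwinEq G u v) where

  TwinEq-of-class : ∀ {u v} → f u ≡ f v → TwinEq G u v
  TwinEq-of-class = Equivalence.to (f≡⇔TwinEq _ _)

  class-of-TwinEq : ∀ {u v} → TwinEq G u v → f u ≡ f v
  class-of-TwinEq = Equivalence.from (f≡⇔TwinEq _ _)

  classes-≢ : ∀ {u v i j} → f u ≡ i → f v ≡ j → i ≢ j → f u ≢ f v
  classes-≢ fu≡i fv≡j i≢j fu≡fv = i≢j (trans (sym fu≡i) (trans fu≡fv fv≡j))

  apart : ∀ {u v i j} → f u ≡ i → f v ≡ j → i ≢ j → u ≢ v
  apart fu≡i fv≡j i≢j = classes-≢ fu≡i fv≡j i≢j ∘ cong f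

  module _ {σ : Fin n ↔ Fin n} (σ-aut : IsAut G σ) where
    open Inverse σ

    IsAut-class : ∀ {u v} → f u ≡ f v → f (to u) ≡ f (to v)
    IsAut-class = class-of-TwinEq ∘ IsAut-TwinEq G {σ} σ-aut ∘ TwinEq-of-class

    IsAut-class⁻ : ∀ {u v} → f (to u) ≡ f (to v) → f u ≡ f v
    IsAut-class⁻ = class-of-TwinEq ∘ IsAut-TwinEq⁻ G {σ} σ-aut ∘ TwinEq-of-class

  Separates : ∀ {k} → (Fin n → Fin k) → Fin 3 → Fin 3 → Set
  Separates c i j = ∃[ u ] f u ≡ i × ∀ v → c v ≡ c u → f v ≢ j

  -- A c-preserving automorphism permutes the classes; Separates c i j forbids it to move
  -- class i onto class j, and these three separations leave only the identity.
  distinguishing-criterion : ∀ {k} (c : Fin n → Fin k) {X Y Z} → X ≢ Y → X ≢ Z → Y ≢ Z →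
    (∀ {u v} → f u ≡ f v → c u ≡ c v → u ≡ v) →
    Separates c X Y → Separates c X Z → Separates c Y Z → Distinguishing G k
  distinguishing-criterion c {X} {Y} {Z} X≢Y X≢Z Y≢Z c-injective sep-XY sep-XZ sep-YZ =
    c , λ σ σ-aut σ-pres u → c-injective (Preserving.keeps-classes {σ} σ-aut σ-pres u) (σ-pres u)
    where
    module Preserving {σ : Fin n ↔ Fin n} (σ-aut : IsAut G σ)
      (σ-pres : ∀ u → c (Inverse.to σ u) ≡ c u) where
      s : Fin n → Fin n
      s = Inverse.to σ

      avoids : ∀ {i j v} → Separates c i j → f v ≡ i → f (s v) ≢ j
      avoids (w , fw≡i , avoid) fv≡i =
        avoid (s w) (σ-pres w) ∘ trans (IsAut-class {σ} σ-aut (trans fw≡i (sym fv≡i)))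

      enters-only-from : ∀ {i j v} → Separates c i j → (∀ {w} → f w ≡ i → f (s w) ≡ i) →
        f (s v) ≡ i → f v ≡ i
      enters-only-from (w , fw≡i , _) i-kept fsv≡i =
        trans (IsAut-class⁻ {σ} σ-aut (trans fsv≡i (sym (i-kept fw≡i)))) fw≡i

      X-kept : ∀ {v} → f v ≡ X → f (s v) ≡ X
      X-kept {v} fv≡X with Fin3-cover X Y Z X≢Y X≢Z Y≢Z (f (s v))
      ... | inj₁ fsv≡X        = fsv≡X
      ... | inj₂ (inj₁ fsv≡Y) = contradiction fsv≡Y (avoids sep-XY fv≡X)
      ... | inj₂ (inj₂ fsv≡Z) = contradiction fsv≡Z (avoids sep-XZ fv≡X)

      Y-kept : ∀ {v} → f v ≡ Y → f (s v) ≡ Y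
      Y-kept {v} fv≡Y with Fin3-cover X Y Z X≢Y X≢Z Y≢Z (f (s v))
      ... | inj₁ fsv≡X        =
        contradiction (trans (sym (enters-only-from sep-XY X-kept fsv≡X)) fv≡Y) X≢Y
      ... | inj₂ (inj₁ fsv≡Y) = fsv≡Y
      ... | inj₂ (inj₂ fsv≡Z) = contradiction fsv≡Z (avoids sep-YZ fv≡Y)

      Z-kept : ∀ {v} → f v ≡ Z → f (s v) ≡ Z
      Z-kept {v} fv≡Z with Fin3-cover X Y Z X≢Y X≢Z Y≢Z (f (s v))
      ... | inj₁ fsv≡X        =
        contradiction (trans (sym (enters-only-from sep-XY X-kept fsv≡X)) fv≡Z) X≢Z
      ... | inj₂ (inj₁ fsv≡Y) =
        contradiction (trans (sym (enters-only-from sep-YZ Y-kept fsv≡Y)) fv≡Z) Y≢Z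
      ... | inj₂ (inj₂ fsv≡Z) = fsv≡Z

      keeps-classes : ∀ u → f (s u) ≡ f u
      keeps-classes u with Fin3-cover X Y Z X≢Y X≢Z Y≢Z (f u)
      ... | inj₁ fu≡X        = trans (X-kept fu≡X) (sym fu≡X)
      ... | inj₂ (inj₁ fu≡Y) = trans (Y-kept fu≡Y) (sym fu≡Y)
      ... | inj₂ (inj₂ fu≡Z) = trans (Z-kept fu≡Z) (sym fu≡Z)

  module _ {k m} {h : Fin k ⊎ Fin k → Fin n} {c : Fin n → Fin m}
    (c-paired : ∀ {x y} → c x ≡ c y → Paired h x y) where

    Paired-class-injective : (∀ s → f (h s) ≢ f (h (swap s))) →
      ∀ {u v} → f u ≡ f v → c u ≡ c v → u ≡ v
    Paired-class-injective pairs-apart fu≡fv cu≡cv with c-paired cu≡cv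
    ... | inj₁ u≡v = u≡v
    ... | inj₂ (s , u≡hs , v≡h[swap-s]) =
      contradiction (trans (cong f (sym u≡hs)) (trans fu≡fv (cong f v≡h[swap-s]))) (pairs-apart s)

    Paired-separates : Injective _≡_ _≡_ h → ∀ s {i j} → f (h s) ≡ i → i ≢ j → f (h (swap s)) ≢ j →
      Separates c i j
    Paired-separates h-injective s {i} {j} fhs≡i i≢j partner-avoids =
      h s , fhs≡i , λ v cv≡chs → avoids (Paired-partner h-injective s (c-paired cv≡chs))
      where
      avoids : ∀ {v} → v ≡ h s ⊎ v ≡ h (swap s) → f v ≢ j
      avoids (inj₁ refl) = i≢j ∘ trans (sym fhs≡i)
      avoids (inj₂ refl) = partner-avoids

m+3≡n⇒n∸2≰m : ∀ {m n} → m + 3 ≡ n → n ∸ 2 ≰ m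
m+3≡n⇒n∸2≰m {m} refl = subst (_≰ m) (sym (+-∸-assoc m (s≤s (s≤s z≤n)))) (m+1+n≰m m)

module TwinGraphK3 {n} (G : Graph n) (f : Fin n → Fin 3)
  (f≡⇔TwinEq : ∀ u v → (f u ≡ f v) ⇔ TwinEq G u v)
  (inhabited : ∀ i → ∃[ u ] f u ≡ i)
  (adjacent : ∀ i j → i ≢ j → ∃[ u ] ∃[ v ] (f u ≡ i × f v ≡ j × adj G u v ≡ true)) where

  open TwinClasses G f f≡⇔TwinEq

  adj-across-classes : ∀ {u v} → f u ≢ f v → adj G u v ≡ true
  adj-across-classes {u} {v} fu≢fv with adjacent (f u) (f v) fu≢fv
  ... | u′ , v′ , fu′≡fu , fv′≡fv , u′~v′ = begin
    adj G u v   ≡⟨ TwinEq-adj G (TwinEq-of-class (sym fu′≡fu))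
                     (apart refl refl (fu≢fv ∘ sym)) (apart refl fu′≡fu (fu≢fv ∘ sym)) ⟩
    adj G u′ v  ≡⟨ Graph.sym G u′ v ⟩
    adj G v u′  ≡⟨ TwinEq-adj G (TwinEq-of-class (sym fv′≡fv))
                     (apart fu′≡fu refl fu≢fv) (apart fu′≡fu fv′≡fv fu≢fv) ⟩
    adj G v′ u′ ≡⟨ Graph.sym G v′ u′ ⟩
    adj G u′ v′ ≡⟨ u′~v′ ⟩
    true        ∎

  NonEdgeIn : Fin 3 → Set
  NonEdgeIn i = ∃[ u ] ∃[ v ] f u ≡ i × f v ≡ i × u ≢ v × adj G u v ≡ false

  NonEdgeIn? : ∀ i → Dec (NonEdgeIn i)
  NonEdgeIn? i = any? λ u → any? λ v →
    (f u ≟ i) ×-dec (f v ≟ i) ×-dec ¬? (u ≟ v) ×-dec (adj G u v Bool.≟ false)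

  TypeOneK-if-no-NonEdge : ∀ {u} → ¬ NonEdgeIn (f u) → TypeOneK G u
  TypeOneK-if-no-NonEdge none v w v~u w~u v≢w with adj G v w in v~w
  ... | true  = refl
  ... | false = contradiction (v , w , class-of-TwinEq v~u , class-of-TwinEq w~u , v≢w , v~w) none

  at-most-one-class-without-non-edge : AtMostOneOneK G →
    ∀ {i j} → i ≢ j → ¬ NonEdgeIn i → ¬ NonEdgeIn j → ⊥
  at-most-one-class-without-non-edge one-OneK {i} {j} i≢j ¬eᵢ ¬eⱼ with inhabited i | inhabited j
  ... | u , refl | v , refl =
    i≢j (class-of-TwinEq (one-OneK u v (TypeOneK-if-no-NonEdge ¬eᵢ) (TypeOneK-if-no-NonEdge ¬eⱼ)))

  two-classes-with-non-edges : AtMostOneOneK G → ∃[ P ] ∃[ Q ] P ≢ Q × NonEdgeIn P × NonEdgeIn Q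
  two-classes-with-non-edges one-OneK with NonEdgeIn? 0F | NonEdgeIn? 1F | NonEdgeIn? 2F
  ... | yes e₀ | yes e₁ | _      = 0F , 1F , (λ ()) , e₀ , e₁
  ... | yes e₀ | no _   | yes e₂ = 0F , 2F , (λ ()) , e₀ , e₂
  ... | no _   | yes e₁ | yes e₂ = 1F , 2F , (λ ()) , e₁ , e₂
  ... | no ¬e₀ | no ¬e₁ | _      = ⊥-elim (at-most-one-class-without-non-edge one-OneK (λ ()) ¬e₀ ¬e₁)
  ... | yes _  | no ¬e₁ | no ¬e₂ = ⊥-elim (at-most-one-class-without-non-edge one-OneK (λ ()) ¬e₁ ¬e₂)
  ... | no ¬e₀ | yes _  | no ¬e₂ = ⊥-elim (at-most-one-class-without-non-edge one-OneK (λ ()) ¬e₀ ¬e₂)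

  -- The couples {x, y}, {x′, z}, {w, y′} share colours: the colour of x′ avoids Y, that of
  -- x avoids Z and that of y avoids Z.
  extra-vertex-distinguishing : ∀ {X Y Z x x′ y y′ z w} → X ≢ Y → X ≢ Z → Y ≢ Z →
    f x ≡ X → f x′ ≡ X → f y ≡ Y → f y′ ≡ Y → f z ≡ Z → f w ≢ Y →
    x ≢ x′ → y ≢ y′ → w ≢ x → w ≢ x′ → w ≢ z →
    ∃[ m ] m + 3 ≡ n × Distinguishing G m
  extra-vertex-distinguishing {X} {Y} {Z} {x} {x′} {y} {y′} {z} {w}
    X≢Y X≢Z Y≢Z fx fx′ fy fy′ fz fw≢Y x≢x′ y≢y′ w≢x w≢x′ w≢z =
    distinguishing (pairing-colouring h h-injective)
    where
    vertices : Vec (Fin n) 6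
    vertices = x ∷ x′ ∷ w ∷ y ∷ z ∷ y′ ∷ []

    vertices-unique : Unique vertices
    vertices-unique =
      (x≢x′ ∷ ≢-sym w≢x ∷ apart fx fy X≢Y ∷ apart fx fz X≢Z ∷ apart fx fy′ X≢Y ∷ []) ∷
      (≢-sym w≢x′ ∷ apart fx′ fy X≢Y ∷ apart fx′ fz X≢Z ∷ apart fx′ fy′ X≢Y ∷ []) ∷
      (apart refl fy fw≢Y ∷ w≢z ∷ apart refl fy′ fw≢Y ∷ []) ∷
      (apart fy fz Y≢Z ∷ y≢y′ ∷ []) ∷
      (apart fz fy′ (≢-sym Y≢Z) ∷ []) ∷
      [] ∷ []

    h : Fin 3 ⊎ Fin 3 → Fin n
    h = lookup vertices ∘ join 3 3

    h-injective : Injective _≡_ _≡_ h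
    h-injective = ↔-injective (↔-sym +↔⊎) ∘ lookup-injective vertices-unique _ _

    pair-apart : ∀ i → f (h (inj₁ i)) ≢ f (h (inj₂ i))
    pair-apart 0F = classes-≢ fx fy X≢Y
    pair-apart 1F = classes-≢ fx′ fz X≢Z
    pair-apart 2F = classes-≢ refl fy′ fw≢Y

    pairs-apart : ∀ s → f (h s) ≢ f (h (swap s))
    pairs-apart (inj₁ i) = pair-apart i
    pairs-apart (inj₂ i) = ≢-sym (pair-apart i)

    distinguishing : (∃[ m ] m + 3 ≡ n × Σ (Fin n → Fin m) λ c → ∀ {u v} → c u ≡ c v → Paired h u v) →
      ∃[ m ] m + 3 ≡ n × Distinguishing G m
    distinguishing (m , m+3≡n , c , c-paired) = m , m+3≡n ,
      distinguishing-criterion c X≢Y X≢Z Y≢Z (Paired-class-injective c-paired pairs-apart)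
        (Paired-separates c-paired h-injective (inj₁ 1F) fx′ X≢Y (≢-sym Y≢Z ∘ trans (sym fz)))
        (Paired-separates c-paired h-injective (inj₁ 0F) fx  X≢Z (Y≢Z ∘ trans (sym fy)))
        (Paired-separates c-paired h-injective (inj₂ 0F) fy  Y≢Z (X≢Z ∘ trans (sym fx)))

  K122-if-enumerated : ∀ {R P Q r p p′ q q′} → R ≢ P → R ≢ Q → P ≢ Q →
    f r ≡ R → f p ≡ P → f p′ ≡ P → f q ≡ Q → f q′ ≡ Q → p ≢ p′ → q ≢ q′ →
    adj G p p′ ≡ false → adj G q q′ ≡ false → (∀ u → u ∈ r ∷ p ∷ p′ ∷ q ∷ q′ ∷ []) → G ≅ K122
  K122-if-enumerated {R} {P} {Q} {r} {p} {p′} {q} {q′}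
    R≢P R≢Q P≢Q fr fp fp′ fq fq′ p≢p′ q≢q′ p≁p′ q≁q′ complete =
    ≅-sym {G = K122} {H = G} (enumeration↔ vertices vertices-unique complete , entries-adj)
    where
    vertices : Vec (Fin n) 5
    vertices = r ∷ p ∷ p′ ∷ q ∷ q′ ∷ []

    vertices-unique : Unique vertices
    vertices-unique =
      (apart fr fp R≢P ∷ apart fr fp′ R≢P ∷ apart fr fq R≢Q ∷ apart fr fq′ R≢Q ∷ []) ∷
      (p≢p′ ∷ apart fp fq P≢Q ∷ apart fp fq′ P≢Q ∷ []) ∷
      (apart fp′ fq P≢Q ∷ apart fp′ fq′ P≢Q ∷ []) ∷
      (q≢q′ ∷ []) ∷
      [] ∷ []

    labels : Vec (Fin 3) 3
    labels = R ∷ P ∷ Q ∷ []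

    labels-unique : Unique labels
    labels-unique = (R≢P ∷ R≢Q ∷ []) ∷ (P≢Q ∷ []) ∷ [] ∷ []

    class-of-entry : ∀ i → f (lookup vertices i) ≡ lookup labels (part 1 2 2 i)
    class-of-entry 0F = fr
    class-of-entry 1F = fp
    class-of-entry 2F = fp′
    class-of-entry 3F = fq
    class-of-entry 4F = fq′

    mates-non-adjacent : ∀ i → adj G (lookup vertices i) (lookup vertices (K122-mate i)) ≡ false
    mates-non-adjacent 0F = Graph.irrefl G r
    mates-non-adjacent 1F = p≁p′
    mates-non-adjacent 2F = trans (Graph.sym G p′ p) p≁p′
    mates-non-adjacent 3F = q≁q′
    mates-non-adjacent 4F = trans (Graph.sym G q′ q) q≁q′

    entries-adj : ∀ i j → adj G (lookup vertices i) (lookup vertices j) ≡ adj K122 i j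
    entries-adj i j with adj K122 i j in i~j
    ... | true = adj-across-classes λ same-class → differ-true⇒≢ i~j
      (lookup-injective labels-unique (part 1 2 2 i) (part 1 2 2 j)
        (trans (sym (class-of-entry i)) (trans same-class (class-of-entry j))))
    ... | false with K122-non-adjacent i j i~j
    ...   | inj₁ refl = Graph.irrefl G _
    ...   | inj₂ refl = mates-non-adjacent i

  dichotomy : AtMostOneOneK G → G ≅ K122 ⊎ ∃[ m ] m + 3 ≡ n × Distinguishing G m
  dichotomy one-OneK with two-classes-with-non-edges one-OneK
  ... | P , Q , P≢Q , (p , p′ , fp , fp′ , p≢p′ , p≁p′) , (q , q′ , fq , fq′ , q≢q′ , q≁q′)
    with Fin3-third P Q P≢Q
  ... | R , P≢R , Q≢R with inhabited R
  ... | r , fr with complete-or-missing (r ∷ p ∷ p′ ∷ q ∷ q′ ∷ [])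
  ... | inj₁ complete = inj₁
    (K122-if-enumerated (≢-sym P≢R) (≢-sym Q≢R) P≢Q fr fp fp′ fq fq′ p≢p′ q≢q′ p≁p′ q≁q′ complete)
  ... | inj₂ (w , w∉) with f w ≟ Q
  ...   | yes fw≡Q = inj₂ (extra-vertex-distinguishing (≢-sym P≢Q) Q≢R P≢R fq fq′ fp fp′ fr
    (λ fw≡P → P≢Q (trans (sym fw≡P) fw≡Q)) q≢q′ p≢p′
    (w∉ ∘ there ∘ there ∘ there ∘ here) (w∉ ∘ there ∘ there ∘ there ∘ there ∘ here) (w∉ ∘ here))
  ...   | no fw≢Q = inj₂ (extra-vertex-distinguishing P≢Q P≢R Q≢R fp fp′ fq fq′ fr
    fw≢Q p≢p′ q≢q′ (w∉ ∘ there ∘ here) (w∉ ∘ there ∘ there ∘ here) (w∉ ∘ here))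

  not-K11 : AtMostOneOneK G → ∀ t → ¬ G ≅ K 1 1 t
  not-K11 one-OneK t (φ , φ-adj) with two-classes-with-non-edges one-OneK
  ... | P , Q , P≢Q , (p , p′ , fp , _ , p≢p′ , p≁p′) , (q , q′ , fq , _ , q≢q′ , q≁q′) =
    contradiction (begin
      true                        ≡⟨ adj-across-classes (classes-≢ fp fq P≢Q) ⟨
      adj G p q                   ≡⟨ φ-adj p q ⟨
      adj (K 1 1 t) (to p) (to q) ≡⟨ K11-non-edges-independent t
                                       (p≢p′ ∘ ↔-injective φ) (trans (φ-adj p p′) p≁p′)
                                       (q≢q′ ∘ ↔-injective φ) (trans (φ-adj q q′) q≁q′) ⟩
      false                       ∎) λ ()
    where open Inverse φ

lemma4p6 : ∀ {n} (G : Graph n) → TwinGraphIsoK3 G → AtMostOneOneK G →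
    (DistNumberIs G (n ∸ 2) ⇔ (G ≅ K 1 2 2 ⊎ Σ ℕ (λ t → 2 ≤ t × G ≅ K 1 1 t)))
lemma4p6 {n} G (f , f≡⇔TwinEq , inhabited , adjacent) one-OneK = mk⇔ K-if-DistNumber DistNumber-if-K
  where
  open TwinGraphK3 G f f≡⇔TwinEq inhabited adjacent

  K-if-DistNumber : DistNumberIs G (n ∸ 2) → G ≅ K 1 2 2 ⊎ Σ ℕ (λ t → 2 ≤ t × G ≅ K 1 1 t)
  K-if-DistNumber (_ , minimal) with dichotomy one-OneK
  ... | inj₁ G≅K122              = inj₁ G≅K122
  ... | inj₂ (m , m+3≡n , dist) = contradiction (minimal m dist) (m+3≡n⇒n∸2≰m m+3≡n)

  DistNumber-if-K : G ≅ K 1 2 2 ⊎ Σ ℕ (λ t → 2 ≤ t × G ≅ K 1 1 t) → DistNumberIs G (n ∸ 2)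
  DistNumber-if-K (inj₁ G≅K122) =
    subst (DistNumberIs G) (cong (_∸ 2) (sym (≅-size {G = G} {K122} G≅K122)))
      (DistNumberIs-≅ {G = G} {K122} G≅K122 K122-DistNumber)
  DistNumber-if-K (inj₂ (t , _ , G≅K11t)) = contradiction G≅K11t (not-K11 one-OneK t)
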